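{- For all positive integers $m$ and $n$, the disjoint union $P_m\cup P_n$ is a $\langle 2,2\rangle$ CCE graph.
   Context: All graphs and digraphs are simple (no loops, no multiple arcs). $P_k$ denotes the path on $k$ vertices ($P_1$ is an isolated vertex). The CCE graph $CCE(D)$ of a digraph $D$ is the graph on $V(D)$ in which distinct $u,v$ are adjacent iff there exist vertices $x,y$ with $(y,u),(y,v),(u,x),(v,x)$ all arcs of $D$. A $\langle 2,2\rangle$ digraph is a digraph in which every vertex has indegree at most $2$ and outdegree at most $2$; a $\langle 2,2\rangle$ CCE graph is a graph isomorphic to the CCE graph of some $\langle 2,2\rangle$ digraph. -}

module Defs where

open import Data.Nat using (ℕ; suc)
open import Data.Fin using (Fin; toℕ)
open import Data.Sum using (_⊎_; inj₁; inj₂)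
open import Data.Product using (Σ; ∃; _×_; _,_)
open import Data.Empty using (⊥)
open import Relation.Nullary using (¬_)
open import Relation.Binary.PropositionalEquality using (_≡_)
open import Function.Bundles using (_↔_; Inverse)

-- A simple digraph on a vertex type V: arc relation without loops
-- (multiple arcs are impossible since Arc is a relation).
record Digraph (V : Set) : Set₁ where
  field
    Arc   : V → V → Set
    loopless : ∀ {v} → ¬ Arc v v

open Digraph

InDegAtMost2 : {V : Set} → Digraph V → V → Set
InDegAtMost2 {V} D v = (a b c : V) → Arc D a v → Arc D b v → Arc D c v →
  (a ≡ b) ⊎ (a ≡ c) ⊎ (b ≡ c)

OutDegAtMost2 : {V : Set} → Digraph V → V → Set
OutDegAtMost2 {V} D v = (a b c : V) → Arc D v a → Arc D v b → Arc D v c →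
  (a ≡ b) ⊎ (a ≡ c) ⊎ (b ≡ c)

Is22 : {V : Set} → Digraph V → Set
Is22 {V} D = (v : V) → InDegAtMost2 D v × OutDegAtMost2 D v

CCEAdj : {V : Set} → Digraph V → V → V → Set
CCEAdj {V} D u v = ¬ (u ≡ v) × Σ V (λ y → Σ V (λ x →
  Arc D y u × Arc D y v × Arc D u x × Arc D v x))

PathAdj : (m : ℕ) → Fin m → Fin m → Set
PathAdj m i j = (suc (toℕ i) ≡ toℕ j) ⊎ (suc (toℕ j) ≡ toℕ i)

UnionPathAdj : (m n : ℕ) → (Fin m ⊎ Fin n) → (Fin m ⊎ Fin n) → Set
UnionPathAdj m n (inj₁ i) (inj₁ j) = PathAdj m i j
UnionPathAdj m n (inj₁ i) (inj₂ j) = ⊥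
UnionPathAdj m n (inj₂ i) (inj₁ j) = ⊥
UnionPathAdj m n (inj₂ i) (inj₂ j) = PathAdj n i j

Is22CCEGraph : {W : Set} → (W → W → Set) → Set₁
Is22CCEGraph {W} G = Σ ℕ λ k → Σ (Digraph (Fin k)) λ D → Σ (Fin k ↔ W) λ φ →
  Is22 D × ((u v : Fin k) →
    (CCEAdj D u v → G (Inverse.to φ u) (Inverse.to φ v)) ×
    (G (Inverse.to φ u) (Inverse.to φ v) → CCEAdj D u v))

-- Put N = m + n and realise P_m ∪ P_n on ℤ/N by the circulant digraph with arcs
-- u → u + (m - 1) and u → u + m, minus the single arc 0 → m - 1. In the full
-- circulant two vertices are CCE-adjacent exactly when they differ by 1, so its
-- CCE graph is the cycle C_N. Deleting 0 → m - 1 removes the only common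
-- in-neighbour of m - 1 and m and the only common out-neighbour of N - 1 and 0,
-- which cuts the cycle into the paths 0, …, m - 1 and m, …, N - 1. A vertex has
-- at most one in- and one out-arc of each length, so the digraph is ⟨2,2⟩.
-- This needs m ≥ 2; P_1 ∪ P_n follows by symmetry, and P_1 ∪ P_1 is the CCE
-- graph of the arcless digraph on two vertices.
module Submission where

open import Defs
open import Data.Empty using (⊥; ⊥-elim)
open import Data.Fin using (Fin; zero; toℕ; fromℕ<; join; _↑ˡ_; _↑ʳ_)
open import Data.Fin.Properties using (toℕ-injective; toℕ<n; toℕ-fromℕ<; toℕ-↑ˡ; toℕ-↑ʳ; +↔⊎)
open import Data.Nat using (ℕ; suc; _+_; _∸_; _≤_; _<_; s≤s; z<s; _<?_; _≤?_)
open import Data.Nat.Properties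
open import Algebra.Properties.CommutativeSemigroup +-commutativeSemigroup using (xy∙z≈xz∙y)
open import Data.Product using (∃; _×_; _,_; proj₁; proj₂)
open import Data.Sum using (_⊎_; inj₁; inj₂; [_,_]′; swap)
import Data.Sum as Sum
open import Data.Sum.Algebra using (⊎-comm)
open import Function using (_∘_)
open import Function.Bundles using (_↔_; Inverse)
open import Function.Properties.Inverse using (↔-trans)
open import Relation.Nullary using (¬_; yes; no)
open import Relation.Binary.PropositionalEquality

module CyclicShift (N : ℕ) where

  -- Shift k u v : v ≡ u + k (mod N), for shifts k ≤ N, which wrap around at most once.
  data Shift (k : ℕ) (u v : Fin N) : Set where
    direct : toℕ u + k ≡ toℕ v     → Shift k u v
    wrap   : toℕ u + k ≡ toℕ v + N → Shift k u v

  private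
    variable
      a b k : ℕ
      u v w : Fin N

    <N⇒≢+N : ∀ {i j} → i < N → i ≢ j + N
    <N⇒≢+N {j = j} i<N i≡j+N = <⇒≱ i<N (subst (N ≤_) (sym i≡j+N) (m≤n+m N j))

    wrap⇒< : toℕ u + k ≡ toℕ v + N → toℕ v < k
    wrap⇒< {u} {k} {v} e = +-cancelʳ-< N (toℕ v) k
      (subst (_< k + N) e (subst (toℕ u + k <_) (+-comm N k) (+-monoˡ-< k (toℕ<n u))))

  shift-functional : Shift k u v → Shift k u w → v ≡ w
  shift-functional (direct e) (direct e′) = toℕ-injective (trans (sym e) e′)
  shift-functional {v = v} (direct e) (wrap e′) = ⊥-elim (<N⇒≢+N (toℕ<n v) (trans (sym e) e′))
  shift-functional {k} {u} (wrap e) (direct e′) = sym (shift-functional {k} {u} (direct e′) (wrap e))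
  shift-functional {v = v} {w} (wrap e) (wrap e′) =
    toℕ-injective (+-cancelʳ-≡ N (toℕ v) (toℕ w) (trans (sym e) e′))

  shift-injective : Shift k u v → Shift k w v → u ≡ w
  shift-injective {k} {u} {w = w} (direct e) (direct e′) =
    toℕ-injective (+-cancelʳ-≡ k (toℕ u) (toℕ w) (trans e (sym e′)))
  shift-injective {k} {u} {v} {w} (direct e) (wrap e′) =
    ⊥-elim (<N⇒≢+N (toℕ<n w) (+-cancelʳ-≡ k (toℕ w) (toℕ u + N) (begin
      toℕ w + k      ≡⟨ e′ ⟩
      toℕ v + N      ≡⟨ cong (_+ N) (sym e) ⟩
      toℕ u + k + N  ≡⟨ xy∙z≈xz∙y (toℕ u) k N ⟩
      toℕ u + N + k  ∎)))
    where open ≡-Reasoning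
  shift-injective {k} {v = v} (wrap e) (direct e′) = sym (shift-injective {k} {v = v} (direct e′) (wrap e))
  shift-injective {k} {u} {w = w} (wrap e) (wrap e′) =
    toℕ-injective (+-cancelʳ-≡ k (toℕ u) (toℕ w) (trans e (sym e′)))

  shift-irreflexive : 0 < k → k < N → ¬ Shift k v v
  shift-irreflexive {k} {v} 0<k _ (direct e) =
    <⇒≢ 0<k (sym (+-cancelˡ-≡ (toℕ v) k 0 (trans e (sym (+-identityʳ (toℕ v))))))
  shift-irreflexive {k} {v} _ k<N (wrap e) = <⇒≢ k<N (+-cancelˡ-≡ (toℕ v) k N e)

  shift-trans : a + b ≤ N → Shift a u v → Shift b v w → Shift (a + b) u w
  shift-trans {a} {b} {u} {v} {w} a+b≤N s t = compose s t
    where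
      reassoc : ∀ {c} → toℕ u + a ≡ c → toℕ u + (a + b) ≡ c + b
      reassoc e = trans (sym (+-assoc (toℕ u) a b)) (cong (_+ b) e)

      compose : Shift a u v → Shift b v w → Shift (a + b) u w
      compose (direct e) (direct e′) = direct (trans (reassoc e) e′)
      compose (direct e) (wrap e′)   = wrap (trans (reassoc e) e′)
      compose (wrap e) (direct e′)   =
        wrap (trans (reassoc e) (trans (xy∙z≈xz∙y (toℕ v) N b) (cong (_+ N) e′)))
      compose (wrap e) (wrap e′)     = ⊥-elim (<⇒≱ u+a+b<N+N N+N≤u+a+b)
        where
          u+a+b<N+N : toℕ u + (a + b) < N + N
          u+a+b<N+N = +-mono-<-≤ (toℕ<n u) a+b≤N
          N+N≤u+a+b : N + N ≤ toℕ u + (a + b)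
          N+N≤u+a+b = ≤-trans (m≤n+m (N + N) (toℕ w)) (≤-reflexive (sym (begin
            toℕ u + (a + b)  ≡⟨ reassoc e ⟩
            toℕ v + N + b    ≡⟨ xy∙z≈xz∙y (toℕ v) N b ⟩
            toℕ v + b + N    ≡⟨ cong (_+ N) e′ ⟩
            toℕ w + N + N    ≡⟨ +-assoc (toℕ w) N N ⟩
            toℕ w + (N + N)  ∎)))
            where open ≡-Reasoning

  shift-total : k ≤ N → (u : Fin N) → ∃ (Shift k u)
  shift-total {k} k≤N u with toℕ u + k <? N
  ... | yes u+k<N = fromℕ< u+k<N , direct (sym (toℕ-fromℕ< u+k<N))
  ... | no u+k≮N = fromℕ< r<N , wrap (trans (sym (m∸n+n≡m N≤u+k)) (cong (_+ N) (sym (toℕ-fromℕ< r<N))))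
    where
      N≤u+k : N ≤ toℕ u + k
      N≤u+k = ≮⇒≥ u+k≮N
      r<N : toℕ u + k ∸ N < N
      r<N = +-cancelʳ-< N _ N
        (subst (_< N + N) (sym (m∸n+n≡m N≤u+k)) (+-mono-<-≤ (toℕ<n u) k≤N))

  shift-surjective : k ≤ N → (v : Fin N) → ∃ λ u → Shift k u v
  shift-surjective {k} k≤N v with k ≤? toℕ v
  ... | yes k≤v = fromℕ< r<N , direct (trans (cong (_+ k) (toℕ-fromℕ< r<N)) (m∸n+n≡m k≤v))
    where
      r<N : toℕ v ∸ k < N
      r<N = ≤-<-trans (m∸n≤m (toℕ v) k) (toℕ<n v)
  ... | no k≰v = fromℕ< r<N , wrap (trans (cong (_+ k) (toℕ-fromℕ< r<N)) (m∸n+n≡m k≤v+N))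
    where
      k≤v+N : k ≤ toℕ v + N
      k≤v+N = ≤-trans k≤N (m≤n+m N (toℕ v))
      r<N : toℕ v + N ∸ k < N
      r<N = +-cancelʳ-< k _ N (subst (_< N + k) (sym (m∸n+n≡m k≤v+N))
        (subst (_< N + k) (+-comm N (toℕ v)) (+-monoʳ-< N (≰⇒> k≰v))))

  shift-cancelˡ : a + b ≤ N → Shift a u v → Shift (a + b) u w → Shift b v w
  shift-cancelˡ {a} {b} {u} {v} {w} a+b≤N u→v u→w
    with shift-total (≤-trans (m≤n+m b a) a+b≤N) v
  ... | w′ , v→w′ = subst (Shift b v) (shift-functional (shift-trans a+b≤N u→v v→w′) u→w) v→w′

  shift-cancelʳ : a + b ≤ N → Shift b v w → Shift (a + b) u w → Shift a u v
  shift-cancelʳ {a} {b} {v} {w} {u} a+b≤N v→w u→w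
    with shift-total (≤-trans (m≤m+n a b) a+b≤N) u
  ... | v′ , u→v′ = subst (Shift a u) (shift-injective v′→w v→w) u→v′
    where
      v′→w : Shift b v′ w
      v′→w = shift-cancelˡ a+b≤N u→v′ u→w

  shift-to-amount : Shift k u v → toℕ v ≡ k → toℕ u ≡ 0
  shift-to-amount {k} {u} (direct e) v≡k = +-cancelʳ-≡ k (toℕ u) 0 (trans e v≡k)
  shift-to-amount {k} {u} (wrap e) v≡k = ⊥-elim (<⇒≢ (toℕ<n u)
    (+-cancelʳ-≡ k (toℕ u) N (trans e (trans (cong (_+ N) v≡k) (+-comm k N)))))

  shift-from-zero : k < N → Shift k u v → toℕ u ≡ 0 → toℕ v ≡ k
  shift-from-zero {k} _ (direct e) u≡0 = trans (sym e) (cong (_+ k) u≡0)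
  shift-from-zero {k} k<N (wrap e) u≡0 = ⊥-elim (<N⇒≢+N k<N (trans (cong (_+ k) (sym u≡0)) e))

  shift-one-direct : Shift 1 u v → toℕ v ≢ 0 → suc (toℕ u) ≡ toℕ v
  shift-one-direct {u} (direct e) _ = trans (+-comm 1 (toℕ u)) e
  shift-one-direct (wrap e) v≢0 = ⊥-elim (v≢0 (n<1⇒n≡0 (wrap⇒< e)))

atMostTwo-⊎ : {A : Set} {P Q : A → Set} →
  (∀ {a b} → P a → P b → a ≡ b) → (∀ {a b} → Q a → Q b → a ≡ b) →
  (a b c : A) → P a ⊎ Q a → P b ⊎ Q b → P c ⊎ Q c → (a ≡ b) ⊎ (a ≡ c) ⊎ (b ≡ c)
atMostTwo-⊎ P! Q! _ _ _ (inj₁ pa) (inj₁ pb) _         = inj₁ (P! pa pb)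
atMostTwo-⊎ P! Q! _ _ _ (inj₂ qa) (inj₂ qb) _         = inj₁ (Q! qa qb)
atMostTwo-⊎ P! Q! _ _ _ (inj₁ pa) (inj₂ qb) (inj₁ pc) = inj₂ (inj₁ (P! pa pc))
atMostTwo-⊎ P! Q! _ _ _ (inj₁ pa) (inj₂ qb) (inj₂ qc) = inj₂ (inj₂ (Q! qb qc))
atMostTwo-⊎ P! Q! _ _ _ (inj₂ qa) (inj₁ pb) (inj₁ pc) = inj₂ (inj₂ (P! pb pc))
atMostTwo-⊎ P! Q! _ _ _ (inj₂ qa) (inj₁ pb) (inj₂ qc) = inj₂ (inj₁ (Q! qa qc))

cce-sym : {V : Set} {D : Digraph V} {u v : V} → CCEAdj D u v → CCEAdj D v u
cce-sym (u≢v , y , x , y→u , y→v , u→x , v→x) = u≢v ∘ sym , y , x , y→v , y→u , v→x , u→x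

-- Consecutive M u v : v = u + 1, with u, v on the same side of the cut between M - 1 and M.
Consecutive : {n : ℕ} → ℕ → Fin n → Fin n → Set
Consecutive M u v = suc (toℕ u) ≡ toℕ v × suc (toℕ u) ≢ M

module Circulant (N p : ℕ) (0<p : 0 < p) (p+1<N : suc p < N) where

  open CyclicShift N

  private
    variable
      u v x y : Fin N

    p<N : p < N
    p<N = <-trans (n<1+n p) p+1<N

    p+1≤N : suc p ≤ N
    p+1≤N = <⇒≤ p+1<N

    2<N : 2 < N
    2<N = ≤-<-trans (s≤s 0<p) p+1<N

    shift-p+1 : Shift (suc p) u v → Shift (p + 1) u v
    shift-p+1 {u} {v} = subst (λ k → Shift k u v) (sym (+-comm p 1))

  Short : Fin N → Fin N → Set
  Short u v = Shift p u v × toℕ u ≢ 0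

  Long : Fin N → Fin N → Set
  Long = Shift (suc p)

  Arc : Fin N → Fin N → Set
  Arc u v = Short u v ⊎ Long u v

  circulant : Digraph (Fin N)
  circulant = record { Arc = Arc ; loopless = loopless }
    where
      loopless : ¬ Arc v v
      loopless (inj₁ (v→v , _)) = shift-irreflexive 0<p p<N v→v
      loopless (inj₂ v→v)       = shift-irreflexive z<s p+1<N v→v

  circulant-is22 : Is22 circulant
  circulant-is22 v =
    atMostTwo-⊎ {P = λ u → Short u v} {Q = λ u → Long u v}
      (λ s s′ → shift-injective (proj₁ s) (proj₁ s′)) shift-injective ,
    atMostTwo-⊎ {P = Short v} {Q = Long v}
      (λ s s′ → shift-functional (proj₁ s) (proj₁ s′)) shift-functional

  short-long-source : Short y u → Long y v → Shift 1 u v × toℕ u ≢ p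
  short-long-source (y→u , y≢0) y→v =
    shift-cancelˡ (≤-trans (≤-reflexive (+-comm p 1)) p+1≤N) y→u (shift-p+1 y→v) ,
    y≢0 ∘ shift-to-amount y→u

  short-long-target : Short v x → Long u x → Shift 1 u v × toℕ v ≢ 0
  short-long-target (v→x , v≢0) u→x = shift-cancelʳ p+1≤N v→x u→x , v≢0

  common-in-neighbour : Arc y u → Arc y v → u ≢ v →
    (Shift 1 u v × toℕ u ≢ p) ⊎ (Shift 1 v u × toℕ v ≢ p)
  common-in-neighbour (inj₁ s) (inj₁ s′) u≢v = ⊥-elim (u≢v (shift-functional (proj₁ s) (proj₁ s′)))
  common-in-neighbour (inj₂ s) (inj₂ s′) u≢v = ⊥-elim (u≢v (shift-functional s s′))
  common-in-neighbour (inj₁ s) (inj₂ s′) _   = inj₁ (short-long-source s s′)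
  common-in-neighbour (inj₂ s) (inj₁ s′) _   = inj₂ (short-long-source s′ s)

  common-out-neighbour : Arc u x → Arc v x → u ≢ v →
    (Shift 1 u v × toℕ v ≢ 0) ⊎ (Shift 1 v u × toℕ u ≢ 0)
  common-out-neighbour (inj₁ s) (inj₁ s′) u≢v = ⊥-elim (u≢v (shift-injective (proj₁ s) (proj₁ s′)))
  common-out-neighbour (inj₂ s) (inj₂ s′) u≢v = ⊥-elim (u≢v (shift-injective s s′))
  common-out-neighbour (inj₂ s) (inj₁ s′) _   = inj₁ (short-long-target s′ s)
  common-out-neighbour (inj₁ s) (inj₂ s′) _   = inj₂ (short-long-target s s′)

  consecutive : Shift 1 u v → toℕ u ≢ p → toℕ v ≢ 0 → Consecutive (suc p) u v
  consecutive u→v u≢p v≢0 = shift-one-direct u→v v≢0 , u≢p ∘ suc-injective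

  cce⇒consecutive : CCEAdj circulant u v → Consecutive (suc p) u v ⊎ Consecutive (suc p) v u
  cce⇒consecutive (u≢v , _ , _ , y→u , y→v , u→x , v→x)
    with common-in-neighbour y→u y→v u≢v | common-out-neighbour u→x v→x u≢v
  ... | inj₁ (u→v , u≢p) | inj₁ (_ , v≢0) = inj₁ (consecutive u→v u≢p v≢0)
  ... | inj₂ (v→u , v≢p) | inj₂ (_ , u≢0) = inj₂ (consecutive v→u v≢p u≢0)
  ... | inj₁ (u→v , _)   | inj₂ (v→u , _) = ⊥-elim (shift-irreflexive z<s 2<N (shift-trans (<⇒≤ 2<N) u→v v→u))
  ... | inj₂ (v→u , _)   | inj₁ (u→v , _) = ⊥-elim (shift-irreflexive z<s 2<N (shift-trans (<⇒≤ 2<N) u→v v→u))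

  consecutive⇒cce : Consecutive (suc p) u v → CCEAdj circulant u v
  consecutive⇒cce {u} {v} (u+1≡v , u+1≢p+1)
    with shift-surjective (<⇒≤ p<N) u | shift-total p+1≤N u
  ... | y , y→u | x , u→x = u≢v , y , x , inj₁ (y→u , y≢0) , inj₂ y→v , inj₂ u→x , inj₁ (v→x , v≢0)
    where
      u→v : Shift 1 u v
      u→v = direct (trans (+-comm (toℕ u) 1) u+1≡v)
      u≢v : u ≢ v
      u≢v refl = 1+n≢n u+1≡v
      v≢0 : toℕ v ≢ 0
      v≢0 v≡0 = 1+n≢0 (trans u+1≡v v≡0)
      y≢0 : toℕ y ≢ 0
      y≢0 y≡0 = u+1≢p+1 (cong suc (shift-from-zero p<N y→u y≡0))
      y→v : Long y v
      y→v = subst (λ k → Shift k y v) (+-comm p 1)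
        (shift-trans (≤-trans (≤-reflexive (+-comm p 1)) p+1≤N) y→u u→v)
      v→x : Shift p v x
      v→x = shift-cancelˡ p+1≤N u→v u→x

module _ {M K : ℕ} where

  private
    consecutive-↑ˡ : {i j : Fin M} → suc (toℕ i) ≡ toℕ j → Consecutive M (i ↑ˡ K) (j ↑ˡ K)
    consecutive-↑ˡ {i} {j} e rewrite toℕ-↑ˡ i K | toℕ-↑ˡ j K =
      e , λ i+1≡M → <⇒≢ (toℕ<n j) (trans (sym e) i+1≡M)

    consecutive-↑ʳ : {i j : Fin K} → suc (toℕ i) ≡ toℕ j → Consecutive M (M ↑ʳ i) (M ↑ʳ j)
    consecutive-↑ʳ {i} {j} e rewrite toℕ-↑ʳ M i | toℕ-↑ʳ M j =
      trans (sym (+-suc M (toℕ i))) (cong (M +_) e) ,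
      λ M+i+1≡M → <⇒≢ (s≤s (m≤m+n M (toℕ i))) (sym M+i+1≡M)

  unionPathAdj⇒consecutive : (a b : Fin M ⊎ Fin K) → UnionPathAdj M K a b →
    Consecutive M (join M K a) (join M K b) ⊎ Consecutive M (join M K b) (join M K a)
  unionPathAdj⇒consecutive (inj₁ _) (inj₁ _) = Sum.map consecutive-↑ˡ consecutive-↑ˡ
  unionPathAdj⇒consecutive (inj₂ _) (inj₂ _) = Sum.map consecutive-↑ʳ consecutive-↑ʳ

  consecutive⇒unionPathAdj : (a b : Fin M ⊎ Fin K) →
    Consecutive M (join M K a) (join M K b) → UnionPathAdj M K a b
  consecutive⇒unionPathAdj (inj₁ i) (inj₁ j) (e , _) rewrite toℕ-↑ˡ i K | toℕ-↑ˡ j K = inj₁ e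
  consecutive⇒unionPathAdj (inj₂ i) (inj₂ j) (e , _) rewrite toℕ-↑ʳ M i | toℕ-↑ʳ M j =
    inj₁ (+-cancelˡ-≡ M _ _ (trans (+-suc M (toℕ i)) e))
  consecutive⇒unionPathAdj (inj₁ i) (inj₂ j) (e , i+1≢M) rewrite toℕ-↑ˡ i K | toℕ-↑ʳ M j =
    i+1≢M (≤-antisym (toℕ<n i) (subst (M ≤_) (sym e) (m≤m+n M (toℕ j))))
  consecutive⇒unionPathAdj (inj₂ i) (inj₁ j) (e , _) rewrite toℕ-↑ʳ M i | toℕ-↑ˡ j K =
    <⇒≱ (toℕ<n j) (subst (M ≤_) e (≤-trans (m≤m+n M (toℕ i)) (n≤1+n (M + toℕ i))))

unionPathAdj-sym : {m n : ℕ} (a b : Fin m ⊎ Fin n) → UnionPathAdj m n a b → UnionPathAdj m n b a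
unionPathAdj-sym (inj₁ _) (inj₁ _) = swap
unionPathAdj-sym (inj₂ _) (inj₂ _) = swap

is22CCE-transport : {W : Set} {G : W → W → Set} {k : ℕ} (φ : Fin k ↔ W) (D : Digraph (Fin k)) → Is22 D →
  (∀ a b → CCEAdj D (Inverse.from φ a) (Inverse.from φ b) → G a b) →
  (∀ a b → G a b → CCEAdj D (Inverse.from φ a) (Inverse.from φ b)) →
  Is22CCEGraph G
is22CCE-transport {k = k} φ D is22 cce⇒G G⇒cce = k , D , φ , is22 , λ u v →
  (λ c → cce⇒G (to u) (to v) (subst₂ (CCEAdj D) (sym (strictlyInverseʳ u)) (sym (strictlyInverseʳ v)) c)) ,
  (λ g → subst₂ (CCEAdj D) (strictlyInverseʳ u) (strictlyInverseʳ v) (G⇒cce (to u) (to v) g))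
  where open Inverse φ

is22CCE-fromConsecutive : {M K : ℕ} (D : Digraph (Fin (M + K))) → Is22 D →
  (∀ {u v} → CCEAdj D u v → Consecutive M u v ⊎ Consecutive M v u) →
  (∀ {u v} → Consecutive M u v → CCEAdj D u v) →
  Is22CCEGraph (UnionPathAdj M K)
is22CCE-fromConsecutive D is22 cce⇒consecutive consecutive⇒cce = is22CCE-transport +↔⊎ D is22
  (λ a b c → [ consecutive⇒unionPathAdj a b , unionPathAdj-sym b a ∘ consecutive⇒unionPathAdj b a ]′
               (cce⇒consecutive c))
  (λ a b g → [ consecutive⇒cce , cce-sym {D = D} ∘ consecutive⇒cce ]′ (unionPathAdj⇒consecutive a b g))

unionPathAdj-swap : {m n : ℕ} (a b : Fin m ⊎ Fin n) → UnionPathAdj m n a b → UnionPathAdj n m (swap a) (swap b)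
unionPathAdj-swap (inj₁ _) (inj₁ _) g = g
unionPathAdj-swap (inj₂ _) (inj₂ _) g = g

unionPathAdj-unswap : {m n : ℕ} (a b : Fin m ⊎ Fin n) → UnionPathAdj n m (swap a) (swap b) → UnionPathAdj m n a b
unionPathAdj-unswap (inj₁ _) (inj₁ _) g = g
unionPathAdj-unswap (inj₂ _) (inj₂ _) g = g

is22CCE-swap : {m n : ℕ} → Is22CCEGraph (UnionPathAdj m n) → Is22CCEGraph (UnionPathAdj n m)
is22CCE-swap {m} {n} (k , D , φ , is22 , iso) = k , D , ↔-trans φ (⊎-comm (Fin m) (Fin n)) , is22 , λ u v →
  (λ c → unionPathAdj-swap (to u) (to v) (proj₁ (iso u v) c)) ,
  (λ g → proj₂ (iso u v) (unionPathAdj-unswap (to u) (to v) g))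
  where open Inverse φ

edgeless : {k : ℕ} → Digraph (Fin k)
edgeless = record { Arc = λ _ _ → ⊥ ; loopless = λ () }

pathAdj-P₁ : (i j : Fin 1) → ¬ PathAdj 1 i j
pathAdj-P₁ zero zero (inj₁ ())
pathAdj-P₁ zero zero (inj₂ ())

P₁∪P₁-is22CCE : Is22CCEGraph (UnionPathAdj 1 1)
P₁∪P₁-is22CCE = is22CCE-transport {G = UnionPathAdj 1 1} +↔⊎ edgeless (λ _ → (λ _ _ _ ()) , (λ _ _ _ ()))
  (λ { _ _ (_ , _ , _ , () , _) })
  λ { (inj₁ i) (inj₁ j) g → ⊥-elim (pathAdj-P₁ i j g)
    ; (inj₂ i) (inj₂ j) g → ⊥-elim (pathAdj-P₁ i j g)
    ; (inj₁ _) (inj₂ _) ()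
    ; (inj₂ _) (inj₁ _) () }

P[2+m]∪P[1+n]-is22CCE : (m n : ℕ) → Is22CCEGraph (UnionPathAdj (2 + m) (suc n))
P[2+m]∪P[1+n]-is22CCE m n = is22CCE-fromConsecutive circulant circulant-is22 cce⇒consecutive consecutive⇒cce
  where open Circulant (2 + m + suc n) (suc m) z<s (m<m+n (2 + m) z<s)

proposition3p4 : (m n : ℕ) → Is22CCEGraph (UnionPathAdj (suc m) (suc n))
proposition3p4 (suc m) n    = P[2+m]∪P[1+n]-is22CCE m n
proposition3p4 0 (suc n)    = is22CCE-swap (P[2+m]∪P[1+n]-is22CCE n 0)
proposition3p4 0 0          = P₁∪P₁-is22CCE
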